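{- Let $t,\delta,\lambda\in\mathbb{N}$, let $G$ be a graph with no subgraph isomorphic to $K_{t+1}$, and let $\mathcal L_0$ be a set of pairwise disjoint paths in $G$ with $|\mathcal L_0|=(10\delta^{t+3}\lambda^3)^t$ such that no two paths in $\mathcal L_0$ are anticomplete in $G$. For each $L\in\mathcal L_0$ let $x_L,y_L$ be a labelling of the ends of $L$ (possibly $x_L=y_L$). Then there are $\delta$ paths $L_1,\dots,L_\delta\in\mathcal L_0$, a vertex $z_{L_i}\in L_i$ for each $i\in\{1,\dots,\delta\}$, and $\delta$ pairwise disjoint $\lambda$-subsets $\mathcal L_1,\dots,\mathcal L_\delta$ of $\mathcal L_0\setminus\{L_1,\dots,L_\delta\}$ such that: (a) the paths $x_{L_i}\text{ - }L_i\text{ - }z_{L_i}$ ($i\in\{1,\dots,\delta\}$) are pairwise anticomplete in $G$; (b) for each $i\in\{1,\dots,\delta\}$, every path $L\in\mathcal L_i$ contains a vertex $w_L\neq x_L$ such that $w_L$ is the only vertex of $w_L\text{ - }L\text{ - }y_L$ with a neighbor in $x_{L_i}\text{ - }L_i\text{ - }z_{L_i}$.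
   Context: Graphs are finite and simple; $\mathbb{N}$ denotes the positive integers. A path in $G$ is an induced subgraph of $G$ that is a path. For vertices $u,v$ of a path $P$, $u\text{ - }P\text{ - }v$ denotes the subpath of $P$ from $u$ to $v$. Two vertex sets (or subgraphs) are anticomplete in $G$ if they are disjoint and no edge of $G$ joins them. -}

module Defs where

open import Data.Nat using (ℕ; zero; suc; _+_; _*_; _^_; _≤_)
open import Data.Fin using (Fin; toℕ; fromℕ)
open import Data.Product using (Σ; ∃; _×_; _,_)
open import Data.Sum using (_⊎_)
open import Relation.Nullary using (¬_; Dec)
open import Relation.Binary.PropositionalEquality using (_≡_; _≢_)
open import Function.Bundles using (_⇔_)

record Graph : Set₁ where
  field
    n      : ℕ
    _~_    : Fin n → Fin n → Set
    ~-sym  : ∀ {u v} → u ~ v → v ~ u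
    ~-irr  : ∀ {v} → ¬ (v ~ v)
    _~?_   : (u v : Fin n) → Dec (u ~ v)

open Graph public

Vtx : Graph → Set
Vtx G = Fin (n G)

HasClique : (G : Graph) → ℕ → Set
HasClique G s = Σ (Fin s → Vtx G) λ f →
  (∀ i j → i ≢ j → _~_ G (f i) (f j))

-- An induced path of G together with a labelling of its ends:
-- vertices vtx 0, ..., vtx len are distinct, and two of them are adjacent
-- iff their indices are consecutive.  x_L = vtx 0, y_L = vtx len.
record LPath (G : Graph) : Set where
  field
    len   : ℕ
    vtx   : Fin (suc len) → Vtx G
    inj   : ∀ i j → vtx i ≡ vtx j → i ≡ j
    induced : ∀ i j →
      (_~_ G (vtx i) (vtx j) ⇔ (toℕ i ≡ suc (toℕ j) ⊎ toℕ j ≡ suc (toℕ i)))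

open LPath public

xEnd : {G : Graph} → LPath G → Vtx G
xEnd L = vtx L Data.Fin.zero

yEnd : {G : Graph} → LPath G → Vtx G
yEnd L = vtx L (fromℕ (len L))

VSet : Graph → Set₁
VSet G = Vtx G → Set

Verts : {G : Graph} → LPath G → VSet G
Verts L v = ∃ λ a → vtx L a ≡ v

Prefix : {G : Graph} (L : LPath G) → Fin (suc (len L)) → VSet G
Prefix L z v = ∃ λ a → (toℕ a ≤ toℕ z) × (vtx L a ≡ v)

Suffix : {G : Graph} (L : LPath G) → Fin (suc (len L)) → VSet G
Suffix L w v = ∃ λ a → (toℕ w ≤ toℕ a) × (vtx L a ≡ v)

Disjoint : {G : Graph} → VSet G → VSet G → Set
Disjoint A B = ∀ v → A v → ¬ B v

Anticomplete : (G : Graph) → VSet G → VSet G → Set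
Anticomplete G A B = Disjoint {G} A B × (∀ u v → A u → B v → ¬ (_~_ G u v))

HasNbrIn : (G : Graph) → Vtx G → VSet G → Set
HasNbrIn G v A = ∃ λ u → A u × _~_ G v u

size0 : ℕ → ℕ → ℕ → ℕ
size0 t δ ℓ = (10 * δ ^ (t + 3) * ℓ ^ 3) ^ t

{-# OPTIONS --safe #-}
module Submission where

-- Ramsey's theorem on the x-ends (G has no K_{t+1}) leaves M = 10δ^{t+3}λ^3 paths with pairwise
-- non-adjacent x-ends; everything else happens among them.  Let k + 1 = δ + δλ, and say that L reaches
-- L′ through a set of vertices of L if one of them is adjacent to a vertex of L′ other than x_{L′}.
-- Walking along L from x_L, the tip z_L is the first vertex such that x_L-L-z_L reaches more than k paths
-- (L is weak if there is none).  The part of L strictly before its tip reaches at most k paths, so this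
-- digraph is sparse and, by double counting, has a large family of pairwise unlinked paths.  Two weak
-- paths are always linked, because they touch and their x-ends do not, so all but one member is strong,
-- and Ramsey's theorem on the tips leaves δ paths whose heads x_L-L-z_L are pairwise anticomplete.  Each
-- head reaches at least δ + δλ paths, so λ of them can be given to each head greedily and disjointly;
-- the vertex w_L is the last vertex of L with a neighbour in the head.

open import Algebra.Properties.CommutativeSemigroup using (x∙yz≈y∙xz)
open import Data.Empty using (⊥; ⊥-elim)
open import Data.Fin as Fin using (Fin; zero; suc; toℕ; inject≤)
import Data.Fin.Properties as Finₚ
open import Data.List using (List; []; _∷_; length; filter; lookup; map; tabulate; allFin; _++_)
open import Data.List.Properties using (length-++; length-tabulate; filter-none)
open import Data.List.Membership.Propositional using (_∈_; _∉_; find)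
open import Data.List.Membership.Propositional.Properties
  using (∈-filter⁺; ∈-filter⁻; ∈-lookup; ∈-tabulate⁺; ∈-AllPairs₂; ∈-++⁺ʳ)
import Data.List.Membership.DecPropositional as DecMembership
open import Data.List.Relation.Binary.Subset.Propositional using (_⊆_)
open import Data.List.Relation.Binary.Subset.Propositional.Properties
  using (filter-⊆; ∷⁺ʳ; ∈-∷⁺ʳ; xs⊆x∷xs; xs⊆xs++ys)
import Data.List.Relation.Binary.Sublist.Propositional as Sublist
import Data.List.Relation.Binary.Sublist.Propositional.Properties as Sublistₚ
open import Data.List.Relation.Unary.All as All using (All; []; _∷_)
import Data.List.Relation.Unary.All.Properties as Allₚ
open import Data.List.Relation.Unary.AllPairs as AllPairs using (AllPairs; []; _∷_)
open import Data.List.Relation.Unary.Any using (here; there; any?)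
open import Data.List.Relation.Unary.Unique.Propositional using (Unique)
import Data.List.Relation.Unary.Unique.Propositional.Properties as Uniqueₚ
open import Data.Nat
  using (ℕ; zero; suc; pred; _+_; _*_; _^_; _≤_; _<_; z≤n; s≤s; s≤s⁻¹; z<s; _≤?_; _<?_; _≟_; >-nonZero)
open import Data.Nat.DivMod using (_mod_; m≤n⇒m%n≡m)
open import Data.Nat.ListAction using (sum)
open import Data.Nat.Properties
open import Data.Nat.Tactic.RingSolver using (solve-∀)
open import Data.Product as Product using (Σ; ∃; _×_; _,_; proj₁; proj₂)
open import Data.Sum as Sum using (_⊎_; inj₁; inj₂)
open import Data.Unit using (⊤; tt)
open import Defs
open import Function using (_∘_; id)
open import Relation.Binary.Definitions using (DecidableEquality; Symmetric; tri<; tri≈; tri>)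
  renaming (Decidable to Decidable₂)
open import Relation.Binary.PropositionalEquality
  using (_≡_; _≢_; refl; sym; trans; cong; cong₂; subst; subst₂; module ≡-Reasoning)
open import Relation.Nullary using (¬_; Dec; yes; no; contradiction; _×-dec_)
open import Relation.Unary using (Decidable)
open import Relation.Unary.Properties using (∁?; _∪?_; _∩?_)

module _ {A : Set} where

  -- Counting in lists

  count : {P : A → Set} → Decidable P → List A → ℕ
  count P? xs = length (filter P? xs)

  length≤count+count∁ : {P : A → Set} (P? : Decidable P) (xs : List A) →
    length xs ≤ count P? xs + count (∁? P?) xs
  length≤count+count∁ P? [] = z≤n
  length≤count+count∁ P? (x ∷ xs) with P? x
  ... | yes _ = s≤s (length≤count+count∁ P? xs)
  ... | no  _ = ≤-trans (s≤s (length≤count+count∁ P? xs)) (≤-reflexive (sym (+-suc _ _)))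

  count-∪ : {P Q : A → Set} (P? : Decidable P) (Q? : Decidable Q) (xs : List A) →
    count (P? ∪? Q?) xs ≤ count P? xs + count Q? xs
  count-∪ P? Q? [] = z≤n
  count-∪ P? Q? (x ∷ xs) with P? x | Q? x
  ... | yes _ | yes _ = s≤s (≤-trans (count-∪ P? Q? xs) (+-monoʳ-≤ (count P? xs) (n≤1+n _)))
  ... | yes _ | no  _ = s≤s (count-∪ P? Q? xs)
  ... | no  _ | yes _ = ≤-trans (s≤s (count-∪ P? Q? xs)) (≤-reflexive (sym (+-suc _ _)))
  ... | no  _ | no  _ = count-∪ P? Q? xs

  count-mono : {P Q : A → Set} (P? : Decidable P) (Q? : Decidable Q) →
    (∀ {x} → P x → Q x) → (xs : List A) → count P? xs ≤ count Q? xs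
  count-mono P? Q? P⇒Q xs =
    Sublistₚ.length-mono-≤ (Sublistₚ.filter⁺ P? Q? (λ { refl → P⇒Q }) (Sublist.⊆-refl {x = xs}))

  count-filter≤ : {P Q : A → Set} (P? : Decidable P) (Q? : Decidable Q) (xs : List A) →
    count P? (filter Q? xs) ≤ count P? xs
  count-filter≤ P? Q? xs =
    Sublistₚ.length-mono-≤ (Sublistₚ.filter⁺ P? P? (λ { refl → id }) (Sublistₚ.filter-⊆ Q? xs))

  count≤1 : {P : A → Set} (P? : Decidable P) {xs : List A} →
    AllPairs (λ x y → ¬ (P x × P y)) xs → count P? xs ≤ 1
  count≤1 P? [] = z≤n
  count≤1 P? {x ∷ xs} (x-alone ∷ rest) with P? x
  ... | no  _  = count≤1 P? rest
  ... | yes px = s≤s (≤-reflexive (cong length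
                   (filter-none P? (All.map (λ not-both py → not-both (px , py)) x-alone))))

  pairwise-∈ : {R : A → A → Set} {xs : List A} → Symmetric R → AllPairs R xs →
    ∀ {x y} → x ∈ xs → y ∈ xs → x ≢ y → R x y
  pairwise-∈ R-sym pairs x∈ y∈ x≢y with ∈-AllPairs₂ pairs x∈ y∈
  ... | inj₁ x≡y        = contradiction x≡y x≢y
  ... | inj₂ (inj₁ Rxy) = Rxy
  ... | inj₂ (inj₂ Ryx) = R-sym Ryx

  unique⇒pairwise : {R : A → A → Set} {xs : List A} → Unique xs →
    (∀ {x y} → x ∈ xs → y ∈ xs → x ≢ y → R x y) → AllPairs R xs
  unique⇒pairwise [] _ = []
  unique⇒pairwise (x-new ∷ u) R-on =
    All.tabulate (λ y∈ → R-on (here refl) (there y∈) (All.lookup x-new y∈))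
      ∷ unique⇒pairwise u (λ x∈ y∈ → R-on (there x∈) (there y∈))

  lookup-pairwise : {R : A → A → Set} {xs : List A} → AllPairs R xs →
    ∀ {i j} → i Fin.< j → R (lookup xs i) (lookup xs j)
  lookup-pairwise {xs = _ ∷ xs} (Rx ∷ _) {zero} {suc j} _ = All.lookup Rx (∈-lookup {xs = xs} j)
  lookup-pairwise (_ ∷ pairs) {suc i} {suc j} (s≤s i<j) = lookup-pairwise pairs i<j

  lookup-symmetric : {R : A → A → Set} {xs : List A} → Symmetric R → AllPairs R xs →
    ∀ {i j} → i ≢ j → R (lookup xs i) (lookup xs j)
  lookup-symmetric R-sym pairs {i} {j} i≢j with Finₚ.<-cmp i j
  ... | tri< i<j _ _ = lookup-pairwise pairs i<j
  ... | tri≈ _ i≡j _ = contradiction i≡j i≢j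
  ... | tri> _ _ j<i = R-sym (lookup-pairwise pairs j<i)

  lookup-injective : {xs : List A} → Unique xs → ∀ {i j} → lookup xs i ≡ lookup xs j → i ≡ j
  lookup-injective u {i} {j} eq with Finₚ.<-cmp i j
  ... | tri< i<j _ _ = contradiction eq (lookup-pairwise u i<j)
  ... | tri≈ _ i≡j _ = i≡j
  ... | tri> _ _ j<i = contradiction (sym eq) (lookup-pairwise u j<i)

  record Subfamily (R : A → A → Set) (m : ℕ) (xs : List A) : Set where
    constructor subfamily
    field
      members  : List A
      unique   : Unique members
      ⊆-xs     : members ⊆ xs
      pairwise : AllPairs R members
      large    : m ≤ length members

  module _ {R : A → A → Set} where

    ∅-subfamily : {xs : List A} → Subfamily R 0 xs
    ∅-subfamily = subfamily [] [] (λ ()) [] z≤n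

    subfamily-⊆ : {m : ℕ} {xs ys : List A} → xs ⊆ ys → Subfamily R m xs → Subfamily R m ys
    subfamily-⊆ xs⊆ys (subfamily I u I⊆xs p l) = subfamily I u (xs⊆ys ∘ I⊆xs) p l

    subfamily-∷ : {m : ℕ} {x : A} {xs : List A} → x ∉ xs → (∀ {y} → y ∈ xs → R x y) →
      Subfamily R m xs → Subfamily R (suc m) (x ∷ xs)
    subfamily-∷ {x = x} x∉xs Rx (subfamily I u I⊆xs p l) =
      subfamily (x ∷ I) (All.tabulate x≢ ∷ u) (∷⁺ʳ x I⊆xs) (All.tabulate (Rx ∘ I⊆xs) ∷ p) (s≤s l)
      where
      x≢ : ∀ {y} → y ∈ I → x ≢ y
      x≢ y∈I refl = x∉xs (I⊆xs y∈I)

    module _ {m : ℕ} {xs : List A} (F : Subfamily R m xs) where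
      open Subfamily F

      enumerate : Fin m → A
      enumerate i = lookup members (inject≤ i large)

      enumerate-injective : ∀ {i j} → enumerate i ≡ enumerate j → i ≡ j
      enumerate-injective eq = Finₚ.inject≤-injective large large _ _ (lookup-injective unique eq)

      enumerate-∈ : ∀ i → enumerate i ∈ xs
      enumerate-∈ i = ⊆-xs (∈-lookup {xs = members} (inject≤ i large))

      enumerate-pairwise : Symmetric R → ∀ {i j} → i ≢ j → R (enumerate i) (enumerate j)
      enumerate-pairwise R-sym i≢j =
        lookup-symmetric R-sym pairwise (i≢j ∘ Finₚ.inject≤-injective large large _ _)

  -- Sparse digraphs and Ramsey's theorem

  sum-map-mono : {f g : A → ℕ} {xs : List A} → All (λ x → f x ≤ g x) xs →
    sum (map f xs) ≤ sum (map g xs)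
  sum-map-mono [] = z≤n
  sum-map-mono (fx≤gx ∷ rest) = +-mono-≤ fx≤gx (sum-map-mono rest)

  sum-map-const : (c : ℕ) (xs : List A) → sum (map (λ _ → c) xs) ≡ length xs * c
  sum-map-const c [] = refl
  sum-map-const c (_ ∷ xs) = cong (c +_) (sum-map-const c xs)

  module Degrees {R : A → A → Set} (R? : Decidable₂ R) where

    indegree : List A → A → ℕ
    indegree xs y = count (λ x → R? x y) xs

    outdegree : List A → A → ℕ
    outdegree ys x = count (R? x) ys

    sum-outdegree-∷ : ∀ y ys xs →
      sum (map (outdegree (y ∷ ys)) xs) ≡ indegree xs y + sum (map (outdegree ys) xs)
    sum-outdegree-∷ y ys [] = refl
    sum-outdegree-∷ y ys (x ∷ xs) with R? x y
    ... | yes _ = cong suc (trans (cong (outdegree ys x +_) (sum-outdegree-∷ y ys xs))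
                                  (x∙yz≈y∙xz +-commutativeSemigroup (outdegree ys x) (indegree xs y) _))
    ... | no  _ = trans (cong (outdegree ys x +_) (sum-outdegree-∷ y ys xs))
                        (x∙yz≈y∙xz +-commutativeSemigroup (outdegree ys x) (indegree xs y) _)

    sum-indegree≡sum-outdegree : ∀ xs ys →
      sum (map (indegree xs) ys) ≡ sum (map (outdegree ys) xs)
    sum-indegree≡sum-outdegree xs [] = sym (trans (sum-map-const 0 xs) (*-zeroʳ (length xs)))
    sum-indegree≡sum-outdegree xs (y ∷ ys) = begin
      indegree xs y + sum (map (indegree xs) ys)
        ≡⟨ cong (indegree xs y +_) (sum-indegree≡sum-outdegree xs ys) ⟩
      indegree xs y + sum (map (outdegree ys) xs)
        ≡⟨ sum-outdegree-∷ y ys xs ⟨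
      sum (map (outdegree (y ∷ ys)) xs)
        ∎
      where open ≡-Reasoning

    low-indegree : ∀ {k} x xs → (∀ a → outdegree (x ∷ xs) a ≤ k) →
      ∃ λ v → v ∈ x ∷ xs × indegree (x ∷ xs) v ≤ k
    low-indegree {k} x xs sparse with any? (λ v → indegree (x ∷ xs) v ≤? k) (x ∷ xs)
    ... | yes found = find found
    ... | no  none  = contradiction
                        (≤-trans in-total (≤-trans (≤-reflexive (sum-indegree≡sum-outdegree S S)) out-total))
                        (<⇒≱ (*-monoʳ-< (length S) (n<1+n k)))
      where
      S : List A
      S = x ∷ xs
      in-total : length S * suc k ≤ sum (map (indegree S) S)
      in-total = subst (_≤ sum (map (indegree S) S)) (sum-map-const (suc k) S)
                       (sum-map-mono {f = λ _ → suc k} (All.map ≰⇒> (Allₚ.¬Any⇒All¬ S none)))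
      out-total : sum (map (outdegree S) S) ≤ length S * k
      out-total = subst (sum (map (outdegree S) S) ≤_) (sum-map-const k S)
                        (sum-map-mono {g = λ _ → k} (All.universal sparse S))

  module _ (_≟_ : DecidableEquality A) where
    open DecMembership _≟_ using (_∈?_)

    count-∈≤length : {ys : List A} → Unique ys → (xs : List A) → count (_∈? xs) ys ≤ length xs
    count-∈≤length {ys} _ [] = ≤-reflexive (cong length (filter-none (_∈? []) (All.universal (λ _ ()) ys)))
    count-∈≤length {ys} u (x ∷ xs) = begin
      count (_∈? x ∷ xs) ys                ≤⟨ count-mono (_∈? x ∷ xs) _ split ys ⟩
      count ((_≟ x) ∪? (_∈? xs)) ys        ≤⟨ count-∪ (_≟ x) (_∈? xs) ys ⟩
      count (_≟ x) ys + count (_∈? xs) ys  ≤⟨ +-mono-≤ (count≤1 (_≟ x) (AllPairs.map both-x u))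
                                                       (count-∈≤length u xs) ⟩
      suc (length xs)                      ∎
      where
      open ≤-Reasoning
      split : ∀ {y} → y ∈ x ∷ xs → y ≡ x ⊎ y ∈ xs
      split (here y≡x) = inj₁ y≡x
      split (there y∈) = inj₂ y∈
      both-x : ∀ {y z} → y ≢ z → ¬ (y ≡ x × z ≡ x)
      both-x y≢z (refl , refl) = y≢z refl

    length≤count∉+length : {ys : List A} → Unique ys → (xs : List A) →
      length ys ≤ count (∁? (_∈? xs)) ys + length xs
    length≤count∉+length {ys} u xs = begin
      length ys                                   ≤⟨ length≤count+count∁ (_∈? xs) ys ⟩
      count (_∈? xs) ys + count (∁? (_∈? xs)) ys  ≤⟨ +-monoˡ-≤ _ (count-∈≤length u xs) ⟩
      length xs + count (∁? (_∈? xs)) ys          ≡⟨ +-comm (length xs) _ ⟩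
      count (∁? (_∈? xs)) ys + length xs          ∎
      where open ≤-Reasoning

    -- By double counting some v has in-degree at most k; v and its at most 2k neighbours are
    -- discarded and the search continues among the rest.
    sparse⇒independent : {R : A → A → Set} (R? : Decidable₂ R) (k j : ℕ) (S : List A) → Unique S →
      (∀ a → Degrees.outdegree R? S a ≤ k) → j * suc (k + k) ≤ length S →
      Subfamily (λ a b → ¬ R a b × ¬ R b a) j S
    sparse⇒independent R? k zero _ _ _ _ = ∅-subfamily
    sparse⇒independent R? k (suc j) [] _ _ ()
    sparse⇒independent {R} R? k (suc j) S@(x ∷ xs) S-unique sparse big
      with v , v∈S , v-in ← Degrees.low-indegree R? x xs sparse =
      subfamily-⊆ (∈-∷⁺ʳ v∈S (filter-⊆ far? S))
        (subfamily-∷ v∉S′ far-from-v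
          (sparse⇒independent R? k j S′ (Uniqueₚ.filter⁺ far? S-unique) sparse′ big′))
      where
      open Degrees R?
      Near : A → Set
      Near u = u ≡ v ⊎ R u v ⊎ R v u
      near? : Decidable Near
      near? = (_≟ v) ∪? ((λ u → R? u v) ∪? R? v)
      far? : Decidable (λ u → ¬ Near u)
      far? = ∁? near?
      S′ : List A
      S′ = filter far? S
      v∉S′ : v ∉ S′
      v∉S′ v∈S′ = proj₂ (∈-filter⁻ far? v∈S′) (inj₁ refl)
      far-from-v : ∀ {u} → u ∈ S′ → ¬ R v u × ¬ R u v
      far-from-v u∈S′ = let far = proj₂ (∈-filter⁻ far? u∈S′)
                        in  far ∘ inj₂ ∘ inj₂ , far ∘ inj₂ ∘ inj₁
      sparse′ : ∀ a → outdegree S′ a ≤ k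
      sparse′ a = ≤-trans (count-filter≤ (R? a) far? S) (sparse a)
      few-near : count near? S ≤ suc (k + k)
      few-near = begin
        count near? S
          ≤⟨ count-∪ (_≟ v) _ S ⟩
        count (_≟ v) S + count ((λ u → R? u v) ∪? R? v) S
          ≤⟨ +-monoʳ-≤ (count (_≟ v) S) (count-∪ (λ u → R? u v) (R? v) S) ⟩
        count (_≟ v) S + (indegree S v + outdegree S v)
          ≤⟨ +-mono-≤ (count≤1 (_≟ v) (AllPairs.map both-v S-unique)) (+-mono-≤ v-in (sparse v)) ⟩
        suc (k + k)
          ∎
        where
        open ≤-Reasoning
        both-v : ∀ {y z} → y ≢ z → ¬ (y ≡ v × z ≡ v)
        both-v y≢z (refl , refl) = y≢z refl
      big′ : j * suc (k + k) ≤ length S′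
      big′ = +-cancelˡ-≤ (suc (k + k)) _ _
               (≤-trans big (≤-trans (length≤count+count∁ near? S) (+-monoˡ-≤ (length S′) few-near)))

    record DisjointPicks (d ℓ : ℕ) (V : Fin d → List A) (U : List A) : Set where
      constructor picks
      field
        pick           : Fin d → Fin ℓ → A
        pick-injective : ∀ i a j b → pick i a ≡ pick j b → i ≡ j × a ≡ b
        pick∉U         : ∀ i a → pick i a ∉ U
        pick∈V         : ∀ i a → pick i a ∈ V i

    disjoint-picks : ∀ {ℓ} d (V : Fin d → List A) → (∀ i → Unique (V i)) → (U : List A) →
      (∀ i → length U + d * ℓ ≤ length (V i)) → DisjointPicks d ℓ V U
    disjoint-picks zero _ _ _ _ = picks (λ ()) (λ ()) (λ ()) (λ ())
    disjoint-picks {ℓ} (suc d) V V-unique U room = picks pick pick-injective pick∉U pick∈V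
      where
      W : List A
      W = filter (∁? (_∈? U)) (V zero)
      W-unique : Unique W
      W-unique = Uniqueₚ.filter⁺ _ (V-unique zero)
      W-large : ℓ ≤ length W
      W-large = +-cancelˡ-≤ (length U) _ _ (begin
        length U + ℓ            ≤⟨ +-monoʳ-≤ (length U) (m≤m+n ℓ (d * ℓ)) ⟩
        length U + (ℓ + d * ℓ)  ≤⟨ room zero ⟩
        length (V zero)         ≤⟨ length≤count∉+length (V-unique zero) U ⟩
        length W + length U     ≡⟨ +-comm (length W) (length U) ⟩
        length U + length W     ∎)
        where open ≤-Reasoning
      first : Subfamily _≢_ ℓ W
      first = subfamily W W-unique id W-unique W-large
      U′ : List A
      U′ = U ++ tabulate (enumerate first)
      room′ : ∀ i → length U′ + d * ℓ ≤ length (V (suc i))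
      room′ i = subst (_≤ length (V (suc i))) (sym U′-size) (room (suc i))
        where
        U′-size : length U′ + d * ℓ ≡ length U + (ℓ + d * ℓ)
        U′-size = trans (cong (_+ d * ℓ) (trans (length-++ U) (cong (length U +_) (length-tabulate _))))
                        (+-assoc (length U) ℓ (d * ℓ))
      module Later = DisjointPicks (disjoint-picks d (V ∘ suc) (V-unique ∘ suc) U′ room′)
      first∈U′ : ∀ a → enumerate first a ∈ U′
      first∈U′ a = ∈-++⁺ʳ U (∈-tabulate⁺ a)
      pick : Fin (suc d) → Fin ℓ → A
      pick zero    = enumerate first
      pick (suc i) = Later.pick i
      pick-injective : ∀ i a j b → pick i a ≡ pick j b → i ≡ j × a ≡ b
      pick-injective zero    a zero    b eq = refl , enumerate-injective first eq
      pick-injective zero    a (suc j) b eq = ⊥-elim (Later.pick∉U j b (subst (_∈ U′) eq (first∈U′ a)))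
      pick-injective (suc i) a zero    b eq =
        ⊥-elim (Later.pick∉U i a (subst (_∈ U′) (sym eq) (first∈U′ b)))
      pick-injective (suc i) a (suc j) b eq = Product.map₁ (cong suc) (Later.pick-injective i a j b eq)
      pick∉U : ∀ i a → pick i a ∉ U
      pick∉U zero    a = proj₂ (∈-filter⁻ (∁? (_∈? U)) {xs = V zero} (enumerate-∈ first a))
      pick∉U (suc i) a = Later.pick∉U i a ∘ xs⊆xs++ys U _
      pick∈V : ∀ i a → pick i a ∈ V i
      pick∈V zero    a = proj₁ (∈-filter⁻ (∁? (_∈? U)) {xs = V zero} (enumerate-∈ first a))
      pick∈V (suc i)   = Later.pick∈V i

  CliqueBounded : (A → A → Set) → (A → Set) → ℕ → Set
  CliqueBounded R Q s = ∀ cs → All Q cs → AllPairs R cs → length cs ≤ s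

  -- A vertex with at least m^(s-1) neighbours hands the search to its neighbourhood, whose cliques are
  -- smaller; any other vertex joins the independent set and only its few neighbours are discarded.
  ramsey : {R : A → A → Set} {Q : A → Set} (R? : Decidable₂ R) (m s : ℕ) → CliqueBounded R Q s →
    (xs : List A) → Unique xs → All Q xs → m ^ s ≤ length xs → Subfamily (λ a b → ¬ R a b) m xs
  ramsey R? m zero bounded (x ∷ _) _ (Qx ∷ _) _ = contradiction (bounded (x ∷ []) (Qx ∷ []) ([] ∷ [])) λ ()
  ramsey {R} {Q} R? m (suc s) bounded xs xs-unique Qxs big = Sum.[ id , id ]′ (grow m xs xs-unique Qxs big)
    where
    Independent : ℕ → List A → Set
    Independent = Subfamily (λ a b → ¬ R a b)
    grow : ∀ j xs → Unique xs → All Q xs → j * m ^ s ≤ length xs → Independent j xs ⊎ Independent m xs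
    grow zero    _ _ _ _ = inj₁ ∅-subfamily
    grow (suc j) [] _ _ big = inj₂ (subfamily [] [] (λ ()) []
      (≤-reflexive (m^n≡0⇒m≡0 m s (n≤0⇒n≡0 (≤-trans (m≤m+n _ _) big)))))
    grow (suc j) (x ∷ xs) xxs-unique@(_ ∷ xs-unique) (Qx ∷ Qxs) big = branch (m ^ s ≤? count (R? x) xs)
      where
      x∉xs : x ∉ xs
      x∉xs = Uniqueₚ.Unique[x∷xs]⇒x∉xs xxs-unique
      ¬R? : Decidable (λ y → ¬ R x y)
      ¬R? = ∁? (R? x)
      neighbourhood-bounded : CliqueBounded R (λ y → Q y × R x y) s
      neighbourhood-bounded cs QRcs pairs =
        s≤s⁻¹ (bounded (x ∷ cs) (Qx ∷ All.map proj₁ QRcs) (All.map proj₂ QRcs ∷ pairs))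
      branch : Dec (m ^ s ≤ count (R? x) xs) → Independent (suc j) (x ∷ xs) ⊎ Independent m (x ∷ xs)
      branch (yes many) =
        inj₂ (subfamily-⊆ (xs⊆x∷xs xs x ∘ filter-⊆ (R? x) xs)
               (ramsey R? m s neighbourhood-bounded (filter (R? x) xs) (Uniqueₚ.filter⁺ (R? x) xs-unique)
                 (All.zip (Allₚ.filter⁺ (R? x) Qxs , Allₚ.all-filter (R? x) xs)) many))
      branch (no few) =
        Sum.map (subfamily-⊆ (∷⁺ʳ x (filter-⊆ ¬R? xs))
                   ∘ subfamily-∷ (x∉xs ∘ filter-⊆ ¬R? xs) (proj₂ ∘ ∈-filter⁻ ¬R? {xs = xs}))
                (subfamily-⊆ (xs⊆x∷xs xs x ∘ filter-⊆ ¬R? xs))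
                (grow j (filter ¬R? xs) (Uniqueₚ.filter⁺ ¬R? xs-unique) (Allₚ.filter⁺ ¬R? Qxs) budget)
        where
        budget : j * m ^ s ≤ count ¬R? xs
        budget = +-cancelˡ-≤ (m ^ s) _ _ (≤-trans big
          (≤-trans (s≤s (length≤count+count∁ (R? x) xs)) (+-monoˡ-≤ (count ¬R? xs) (≰⇒> few))))

record Crossing (f : ℕ → ℕ) (k n : ℕ) : Set where
  constructor crossing-at
  field
    point   : ℕ
    point≤n : point ≤ n
    below   : f point ≤ k
    stops   : point ≡ n ⊎ k < f (suc point)

crossing : (f : ℕ → ℕ) {k : ℕ} → f 0 ≤ k → (n : ℕ) → Crossing f k n
crossing f f0≤k zero = crossing-at 0 z≤n f0≤k (inj₁ refl)
crossing f {k} f0≤k (suc n) with f 1 ≤? k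
... | no  f1>k = crossing-at 0 z≤n f0≤k (inj₂ (≰⇒> f1>k))
... | yes f1≤k = let crossing-at m m≤n fm≤k stops = crossing (f ∘ suc) f1≤k n
                 in  crossing-at (suc m) (s≤s m≤n) fm≤k (Sum.map₁ (cong suc) stops)

greatest-satisfying : ∀ {n} {P : Fin n → Set} → Decidable P →
  (∀ i → ¬ P i) ⊎ ∃ λ w → P w × (∀ i → w Fin.< i → ¬ P i)
greatest-satisfying {zero} P? = inj₁ (λ ())
greatest-satisfying {suc _} P? with greatest-satisfying (P? ∘ suc)
... | inj₂ (w , Pw , above) = inj₂ (suc w , Pw , λ { zero () ; (suc i) w<i → above i (s≤s⁻¹ w<i) })
... | inj₁ none with P? zero
...   | yes P0  = inj₂ (zero , P0 , λ { zero () ; (suc i) _ → none i })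
...   | no  ¬P0 = inj₁ (λ { zero → ¬P0 ; (suc i) → none i })

module _ (G : Graph) where
  open Graph G using () renaming (_~_ to _∼_; ~-sym to ∼-sym)

  no-clique⇒clique-bounded : ∀ {A : Set} {Q : A → Set} t → ¬ HasClique G (t + 1) → (φ : A → Vtx G) →
    CliqueBounded (λ a b → φ a ∼ φ b) Q t
  no-clique⇒clique-bounded t no-clique φ cs _ pairs with length cs ≤? t
  ... | yes small = small
  ... | no  big   = contradiction (f , f-clique) no-clique
    where
    t+1≤ : t + 1 ≤ length cs
    t+1≤ = subst (_≤ length cs) (+-comm 1 t) (≰⇒> big)
    f : Fin (t + 1) → Vtx G
    f i = φ (lookup cs (inject≤ i t+1≤))
    f-clique : ∀ i j → i ≢ j → f i ∼ f j
    f-clique i j i≢j = lookup-symmetric ∼-sym pairs (i≢j ∘ Finₚ.inject≤-injective t+1≤ t+1≤ i j)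

  anticomplete-sym : {X Y : VSet G} → Anticomplete G X Y → Anticomplete G Y X
  anticomplete-sym (disjoint , no-edge) =
    (λ v Yv Xv → disjoint v Xv Yv) , λ u v Yu Xv u∼v → no-edge v u Xv Yu (∼-sym u∼v)

module HeadsAndFollowers (G : Graph) {N : ℕ} (L : Fin N → LPath G)
  (L-disjoint : ∀ a b → a ≢ b → Disjoint {G} (Verts (L a)) (Verts (L b)))
  (L-touching : ∀ a b → a ≢ b → ¬ Anticomplete G (Verts (L a)) (Verts (L b)))
  (P : List (Fin N)) (P-unique : Unique P)
  (P-ends : AllPairs (λ a b → ¬ _~_ G (xEnd (L a)) (xEnd (L b))) P)
  (k : ℕ) where

  open Graph G using () renaming (_~_ to _∼_; ~-sym to ∼-sym; _~?_ to _∼?_)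

  ends-independent : ∀ {a b} → a ∈ P → b ∈ P → a ≢ b → ¬ xEnd (L a) ∼ xEnd (L b)
  ends-independent = pairwise-∈ (_∘ ∼-sym) P-ends

  edge-between : ∀ a b → a ≢ b → ∃ λ i → ∃ λ j → vtx (L a) i ∼ vtx (L b) j
  edge-between a b a≢b with Finₚ.any? (λ i → Finₚ.any? (λ j → vtx (L a) i ∼? vtx (L b) j))
  ... | yes edge = edge
  ... | no  none = contradiction (L-disjoint a b a≢b , λ { _ _ (i , refl) (j , refl) e → none (i , j , e) })
                                 (L-touching a b a≢b)

  -- Index 0 of L b, its x-end, is excluded; this is what makes w differ from x_b in the end.
  Reaches : Fin N → ℕ → Fin N → Set
  Reaches a m b = Σ (Fin (suc (len (L a)))) λ i → Σ (Fin (suc (len (L b)))) λ j →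
    toℕ i < m × 0 < toℕ j × vtx (L a) i ∼ vtx (L b) j

  reaches? : ∀ a m → Decidable (Reaches a m)
  reaches? a m b = Finₚ.any? λ i → Finₚ.any? λ j →
    (toℕ i <? m) ×-dec (0 <? toℕ j) ×-dec (vtx (L a) i ∼? vtx (L b) j)

  reach : Fin N → ℕ → ℕ
  reach a m = count (reaches? a m) P

  cut : (a : Fin N) → Crossing (reach a) k (suc (len (L a)))
  cut a = crossing (reach a) (subst (_≤ k) (sym nothing-reached) z≤n) _
    where
    nothing-reached : reach a 0 ≡ 0
    nothing-reached = cong length (filter-none (reaches? a 0) (All.universal (λ { _ (_ , _ , () , _) }) P))

  -- The index of the tip z_a on a strong path; len + 1 on a weak one.
  depth : Fin N → ℕ
  depth a = Crossing.point (cut a)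

  _⇝_ : Fin N → Fin N → Set
  a ⇝ b = Reaches a (depth a) b

  Unlinked : Fin N → Fin N → Set
  Unlinked a b = ¬ a ⇝ b × ¬ b ⇝ a

  Strong : Fin N → Set
  Strong a = depth a ≤ len (L a)

  strong? : Decidable Strong
  strong? a = depth a ≤? len (L a)

  many-reached : ∀ a → Strong a → k < reach a (suc (depth a))
  many-reached a strong = Sum.[ (λ ran-out → contradiction (subst (_≤ len (L a)) ran-out strong) 1+n≰n) , id ]′
                                (Crossing.stops (cut a))

  weak⇒<depth : ∀ a → ¬ Strong a → ∀ i → toℕ i < depth a
  weak⇒<depth a weak i =
    subst (toℕ i <_) (sym (≤-antisym (Crossing.point≤n (cut a)) (≰⇒> weak))) (Finₚ.toℕ<n i)

  weak-pair : ∀ {a b} → a ∈ P → b ∈ P → a ≢ b → ¬ Strong a → ¬ Strong b → a ⇝ b ⊎ b ⇝ a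
  weak-pair {a} {b} a∈P b∈P a≢b weak-a weak-b with edge-between a b a≢b
  ... | zero  , zero  , e = contradiction e (ends-independent a∈P b∈P a≢b)
  ... | i     , suc j , e = inj₁ (i , suc j , weak⇒<depth a weak-a i , z<s , e)
  ... | suc i , zero  , e = inj₂ (zero , suc i , weak⇒<depth b weak-b zero , z<s , ∼-sym e)

  -- Reducing mod (len + 1) only makes tip total: on strong paths it does nothing.
  tip : (a : Fin N) → Fin (suc (len (L a)))
  tip a = depth a mod suc (len (L a))

  toℕ-tip : ∀ a → Strong a → toℕ (tip a) ≡ depth a
  toℕ-tip a strong = trans (Finₚ.toℕ-fromℕ< _) (m≤n⇒m%n≡m strong)

  tip-vertex : Fin N → Vtx G
  tip-vertex a = vtx (L a) (tip a)

  Head : Fin N → VSet G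
  Head a = Prefix (L a) (tip a)

  SeparateHeads : Fin N → Fin N → Set
  SeparateHeads a b = Anticomplete G (Head a) (Head b)

  separate-heads-by-index : ∀ {a b} → a ≢ b → Strong a → Strong b →
    (∀ i j → toℕ i ≤ depth a → toℕ j ≤ depth b → ¬ vtx (L a) i ∼ vtx (L b) j) → SeparateHeads a b
  separate-heads-by-index {a} {b} a≢b sa sb no-edge = disjoint , λ { _ _ (i , i≤ , refl) (j , j≤ , refl) →
      no-edge i j (subst (toℕ i ≤_) (toℕ-tip a sa) i≤) (subst (toℕ j ≤_) (toℕ-tip b sb) j≤) }
    where
    disjoint : Disjoint {G} (Head a) (Head b)
    disjoint v (i , _ , ai≡v) (j , _ , bj≡v) = L-disjoint a b a≢b v (i , ai≡v) (j , bj≡v)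

  Trivial : Fin N → Set
  Trivial a = Strong a × depth a ≡ 0

  trivial? : Decidable Trivial
  trivial? = strong? ∩? λ a → depth a ≟ 0

  trivial-heads-separate : ∀ {a b} → a ∈ P → b ∈ P → a ≢ b → Trivial a → Trivial b → SeparateHeads a b
  trivial-heads-separate a∈P b∈P a≢b (sa , da≡0) (sb , db≡0) = separate-heads-by-index a≢b sa sb no-edge
    where
    no-edge : ∀ i j → toℕ i ≤ _ → toℕ j ≤ _ → ¬ _
    no-edge zero    zero    _  _  = ends-independent a∈P b∈P a≢b
    no-edge (suc _) _       i≤ _  = contradiction (subst (_ ≤_) da≡0 i≤) λ ()
    no-edge zero    (suc _) _  j≤ = contradiction (subst (_ ≤_) db≡0 j≤) λ ()

  Deep : Fin N → Set
  Deep a = Strong a × 0 < depth a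

  deep-heads-separate : ∀ {a b} → a ∈ P → b ∈ P → a ≢ b → Deep a → Deep b → Unlinked a b →
    ¬ tip-vertex a ∼ tip-vertex b → SeparateHeads a b
  deep-heads-separate {a} {b} a∈P b∈P a≢b (sa , 0<da) (sb , 0<db) (¬a⇝b , ¬b⇝a) tips-apart =
    separate-heads-by-index a≢b sa sb no-edge
    where
    at-tip : ∀ {c} → Strong c → (i : Fin (suc (len (L c)))) →
      toℕ i ≤ depth c → ¬ toℕ i < depth c → i ≡ tip c
    at-tip {c} sc i i≤ i≮ =
      Finₚ.toℕ-injective (trans (≤-antisym i≤ (≮⇒≥ i≮)) (sym (toℕ-tip c sc)))
    no-edge : ∀ i j → toℕ i ≤ depth a → toℕ j ≤ depth b → ¬ vtx (L a) i ∼ vtx (L b) j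
    no-edge zero      zero      _  _  = ends-independent a∈P b∈P a≢b
    no-edge zero      (suc j)   _  _  = λ e → ¬a⇝b (zero , suc j , 0<da , z<s , e)
    no-edge (suc i)   zero      _  _  = λ e → ¬b⇝a (zero , suc i , 0<db , z<s , ∼-sym e)
    no-edge i@(suc _) j@(suc _) i≤ j≤ e = by-position (toℕ i <? depth a) (toℕ j <? depth b)
      where
      by-position : Dec (toℕ i < depth a) → Dec (toℕ j < depth b) → ⊥
      by-position (yes i<) _        = ¬a⇝b (i , j , i< , z<s , e)
      by-position (no  _)  (yes j<) = ¬b⇝a (j , i , j< , z<s , ∼-sym e)
      by-position (no  i≮) (no  j≮) =
        tips-apart (subst₂ (λ i j → vtx (L a) i ∼ vtx (L b) j) (at-tip sa i i≤ i≮) (at-tip sb j j≤ j≮) e)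

  trivial-centres : ∀ {δ} → δ ≤ count trivial? P → Subfamily SeparateHeads δ (filter strong? P)
  trivial-centres many = subfamily T T-unique T⊆ (unique⇒pairwise T-unique separate) many
    where
    T : List (Fin N)
    T = filter trivial? P
    T-unique : Unique T
    T-unique = Uniqueₚ.filter⁺ trivial? P-unique
    T⊆ : T ⊆ filter strong? P
    T⊆ a∈T = let a∈P , sa , _ = ∈-filter⁻ trivial? {xs = P} a∈T in ∈-filter⁺ strong? a∈P sa
    separate : ∀ {a b} → a ∈ T → b ∈ T → a ≢ b → SeparateHeads a b
    separate a∈T b∈T a≢b =
      let a∈P , ta = ∈-filter⁻ trivial? {xs = P} a∈T
          b∈P , tb = ∈-filter⁻ trivial? {xs = P} b∈T
      in  trivial-heads-separate a∈P b∈P a≢b ta tb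

  unlinked-family : ∀ {m} → m * suc (k + k) ≤ count (∁? trivial?) P →
    Subfamily Unlinked m (filter (∁? trivial?) P)
  unlinked-family big =
    sparse⇒independent Finₚ._≟_ (λ a → reaches? a (depth a)) k _ _
      (Uniqueₚ.filter⁺ (∁? trivial?) P-unique)
      (λ a → ≤-trans (count-filter≤ _ (∁? trivial?) P) (Crossing.below (cut a))) big

  mostly-strong : ∀ {m xs} → xs ⊆ P → (F : Subfamily Unlinked (suc m) xs) →
    m ≤ count strong? (Subfamily.members F)
  mostly-strong {m} xs⊆P F = s≤s⁻¹ (begin
    suc m                                        ≤⟨ large ⟩
    length members                               ≤⟨ length≤count+count∁ strong? members ⟩
    count strong? members + count weak? members  ≤⟨ +-monoʳ-≤ _ (count≤1 weak? weak-alone) ⟩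
    count strong? members + 1                    ≡⟨ +-comm _ 1 ⟩
    suc (count strong? members)                  ∎)
    where
    open Subfamily F
    open ≤-Reasoning
    weak? : Decidable (λ a → ¬ Strong a)
    weak? = ∁? strong?
    not-both-weak : ∀ {a b} → a ∈ members → b ∈ members → a ≢ b → ¬ (¬ Strong a × ¬ Strong b)
    not-both-weak a∈ b∈ a≢b (weak-a , weak-b) =
      let ¬a⇝b , ¬b⇝a = pairwise-∈ Product.swap pairwise a∈ b∈ a≢b
      in  Sum.[ ¬a⇝b , ¬b⇝a ]′ (weak-pair (xs⊆P (⊆-xs a∈)) (xs⊆P (⊆-xs b∈)) a≢b weak-a weak-b)
    weak-alone : AllPairs (λ a b → ¬ (¬ Strong a × ¬ Strong b)) members
    weak-alone = unique⇒pairwise unique not-both-weak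

  deep-centres : ∀ t δ → ¬ HasClique G (t + 1) → suc (δ ^ t) * suc (k + k) ≤ count (∁? trivial?) P →
    Subfamily SeparateHeads δ (filter strong? P)
  deep-centres t δ no-clique big =
    subfamily C (Subfamily.unique tips) C⊆ (unique⇒pairwise (Subfamily.unique tips) separate)
      (Subfamily.large tips)
    where
    I : Subfamily Unlinked (suc (δ ^ t)) (filter (∁? trivial?) P)
    I = unlinked-family big
    S : List (Fin N)
    S = filter strong? (Subfamily.members I)
    tips-adjacent? : Decidable₂ (λ a b → tip-vertex a ∼ tip-vertex b)
    tips-adjacent? a b = tip-vertex a ∼? tip-vertex b
    tips : Subfamily (λ a b → ¬ tip-vertex a ∼ tip-vertex b) δ S
    tips = ramsey {Q = λ _ → ⊤} tips-adjacent? δ t (no-clique⇒clique-bounded G t no-clique tip-vertex) S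
             (Uniqueₚ.filter⁺ strong? (Subfamily.unique I)) (All.universal (λ _ → tt) S)
             (mostly-strong (proj₁ ∘ ∈-filter⁻ (∁? trivial?) {xs = P}) I)
    C : List (Fin N)
    C = Subfamily.members tips
    in-I : ∀ {a} → a ∈ C → a ∈ Subfamily.members I
    in-I = proj₁ ∘ ∈-filter⁻ strong? {xs = Subfamily.members I} ∘ Subfamily.⊆-xs tips
    deep-member : ∀ {a} → a ∈ C → a ∈ P × Deep a
    deep-member a∈C =
      let a∈P , not-trivial = ∈-filter⁻ (∁? trivial?) {xs = P} (Subfamily.⊆-xs I (in-I a∈C))
          sa = proj₂ (∈-filter⁻ strong? {xs = Subfamily.members I} (Subfamily.⊆-xs tips a∈C))
      in  a∈P , sa , n≢0⇒n>0 (not-trivial ∘ (sa ,_))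
    C⊆ : C ⊆ filter strong? P
    C⊆ a∈C = ∈-filter⁺ strong? (proj₁ (deep-member a∈C)) (proj₁ (proj₂ (deep-member a∈C)))
    separate : ∀ {a b} → a ∈ C → b ∈ C → a ≢ b → SeparateHeads a b
    separate a∈C b∈C a≢b =
      deep-heads-separate (proj₁ (deep-member a∈C)) (proj₁ (deep-member b∈C)) a≢b
        (proj₂ (deep-member a∈C)) (proj₂ (deep-member b∈C))
        (pairwise-∈ Product.swap (Subfamily.pairwise I) (in-I a∈C) (in-I b∈C) a≢b)
        (pairwise-∈ (_∘ ∼-sym) (Subfamily.pairwise tips) a∈C b∈C a≢b)

  -- A tip at index 0 is an x-end, which no path reaches; such heads are separated by the independence
  -- of the x-ends alone.
  centres : ∀ t δ → ¬ HasClique G (t + 1) → suc (δ ^ t) * suc (k + k) + δ ≤ length P →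
    Subfamily SeparateHeads δ (filter strong? P)
  centres t δ no-clique big = by-count (δ ≤? count trivial? P)
    where
    by-count : Dec (δ ≤ count trivial? P) → Subfamily SeparateHeads δ (filter strong? P)
    by-count (yes many) = trivial-centres many
    by-count (no  few)  = deep-centres t δ no-clique (+-cancelʳ-≤ δ _ _ (begin
      suc (δ ^ t) * suc (k + k) + δ             ≤⟨ big ⟩
      length P                                  ≤⟨ length≤count+count∁ trivial? P ⟩
      count trivial? P + count (∁? trivial?) P  ≤⟨ +-monoˡ-≤ _ (<⇒≤ (≰⇒> few)) ⟩
      δ + count (∁? trivial?) P                 ≡⟨ +-comm δ _ ⟩
      count (∁? trivial?) P + δ                 ∎))
      where open ≤-Reasoning

  head? : ∀ c → Decidable (Head c)
  head? c u = Finₚ.any? (λ i → (toℕ i ≤? toℕ (tip c)) ×-dec (vtx (L c) i Finₚ.≟ u))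

  attached? : ∀ c b → Decidable (λ p → HasNbrIn G (vtx (L b) p) (Head c))
  attached? c b p = Finₚ.any? (λ u → head? c u ×-dec (vtx (L b) p ∼? u))

  attachment : ∀ c b → Strong c → Reaches c (suc (depth c)) b →
    Σ (Fin (suc (len (L b)))) λ w → vtx (L b) w ≢ xEnd (L b) × HasNbrIn G (vtx (L b) w) (Head c) ×
      (∀ p → toℕ w ≤ toℕ p → p ≢ w → ¬ HasNbrIn G (vtx (L b) p) (Head c))
  attachment c b sc (i , j , i≤ , 0<j , e) = last-attached (greatest-satisfying (attached? c b))
    where
    Attached : Fin (suc (len (L b))) → Set
    Attached p = HasNbrIn G (vtx (L b) p) (Head c)
    j-attached : Attached j
    j-attached = vtx (L c) i , (i , subst (toℕ i ≤_) (sym (toℕ-tip c sc)) (s≤s⁻¹ i≤) , refl) , ∼-sym e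
    last-attached : (∀ p → ¬ Attached p) ⊎ ∃ (λ w → Attached w × ∀ p → w Fin.< p → ¬ Attached p) →
      Σ (Fin (suc (len (L b)))) λ w → vtx (L b) w ≢ xEnd (L b) × Attached w ×
        (∀ p → toℕ w ≤ toℕ p → p ≢ w → ¬ Attached p)
    last-attached (inj₁ none) = contradiction j-attached (none j)
    last-attached (inj₂ (w , w-attached , above)) =
      w , w≢x , w-attached , λ p w≤p p≢w → above p (Finₚ.≤∧≢⇒< w≤p (p≢w ∘ sym))
      where
      j≤w : toℕ j ≤ toℕ w
      j≤w = ≮⇒≥ (λ w<j → above j w<j j-attached)
      w≢x : vtx (L b) w ≢ xEnd (L b)
      w≢x w≡x = <⇒≱ 0<j (subst (λ w → toℕ j ≤ toℕ w) (inj (L b) w zero w≡x) j≤w)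

  module Selection (t δ ℓ : ℕ) (no-clique : ¬ HasClique G (t + 1)) (threshold : suc k ≡ δ + δ * ℓ)
    (big : suc (δ ^ t) * suc (k + k) + δ ≤ length P) where

    opaque
      centre-family : Subfamily SeparateHeads δ (filter strong? P)
      centre-family = centres t δ no-clique big

    sel : Fin δ → Fin N
    sel = enumerate centre-family

    sel-injective : ∀ i j → sel i ≡ sel j → i ≡ j
    sel-injective _ _ = enumerate-injective centre-family

    sel-strong : ∀ i → Strong (sel i)
    sel-strong i = proj₂ (∈-filter⁻ strong? {xs = P} (enumerate-∈ centre-family i))

    sel-separate : ∀ i j → i ≢ j → SeparateHeads (sel i) (sel j)
    sel-separate _ _ = enumerate-pairwise centre-family (anticomplete-sym G)

    candidates : Fin N → List (Fin N)
    candidates c = filter (reaches? c (suc (depth c))) P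

    candidates-unique : ∀ c → Unique (candidates c)
    candidates-unique c = Uniqueₚ.filter⁺ (reaches? c (suc (depth c))) P-unique

    room : ∀ i → length (tabulate sel) + δ * ℓ ≤ length (candidates (sel i))
    room i = begin
      length (tabulate sel) + δ * ℓ  ≡⟨ cong (_+ δ * ℓ) (length-tabulate sel) ⟩
      δ + δ * ℓ                      ≡⟨ threshold ⟨
      suc k                          ≤⟨ many-reached (sel i) (sel-strong i) ⟩
      length (candidates (sel i))    ∎
      where open ≤-Reasoning

    followers : DisjointPicks Finₚ._≟_ δ ℓ (candidates ∘ sel) (tabulate sel)
    followers = disjoint-picks Finₚ._≟_ δ (candidates ∘ sel) (candidates-unique ∘ sel) (tabulate sel) room

    open DisjointPicks followers public using (pick; pick-injective)

    pick≢sel : ∀ i a j → pick i a ≢ sel j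
    pick≢sel i a j eq = DisjointPicks.pick∉U followers i a (subst (_∈ tabulate sel) (sym eq) (∈-tabulate⁺ j))

    pick-attached : ∀ i a → Σ (Fin (suc (len (L (pick i a))))) λ w →
      vtx (L (pick i a)) w ≢ xEnd (L (pick i a)) × HasNbrIn G (vtx (L (pick i a)) w) (Head (sel i)) ×
      (∀ p → toℕ w ≤ toℕ p → p ≢ w → ¬ HasNbrIn G (vtx (L (pick i a)) p) (Head (sel i)))
    pick-attached i a = attachment (sel i) (pick i a) (sel-strong i) (proj₂ (∈-filter⁻ (reaches? (sel i) _)
      {xs = P} (DisjointPicks.pick∈V followers i a)))

n≤n^3 : ∀ n → 1 ≤ n → n ≤ n ^ 3
n≤n^3 n@(suc _) _ = subst (_≤ n ^ 3) (*-identityʳ n) (^-monoʳ-≤ n {1} {3} (s≤s z≤n))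

size-bound : ∀ {t δ ℓ k} → 1 ≤ δ → 1 ≤ ℓ → suc k ≡ δ + δ * ℓ →
  suc (δ ^ t) * suc (k + k) + δ ≤ 10 * δ ^ (t + 3) * ℓ ^ 3
size-bound {t} {δ} {ℓ} {k} δ≥1 ℓ≥1 k-def = begin
  suc a * suc (k + k) + δ
    ≤⟨ +-mono-≤ (*-mono-≤ (+-monoˡ-≤ a a≥1) 2k+1≤) δ≤aδℓ ⟩
  (a + a) * ((δ * ℓ + δ * ℓ) + (δ * ℓ + δ * ℓ)) + a * (δ * ℓ)
    ≡⟨ nine-times a δ ℓ ⟩
  9 * (a * (δ * ℓ))
    ≤⟨ *-mono-≤ (n≤1+n 9) (*-monoʳ-≤ a (*-mono-≤ (n≤n^3 δ δ≥1) (n≤n^3 ℓ ℓ≥1))) ⟩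
  10 * (a * (δ ^ 3 * ℓ ^ 3))
    ≡⟨ regroup a (δ ^ 3) (ℓ ^ 3) ⟩
  10 * (a * δ ^ 3) * ℓ ^ 3
    ≡⟨ cong (λ x → 10 * x * ℓ ^ 3) (^-distribˡ-+-* δ t 3) ⟨
  10 * δ ^ (t + 3) * ℓ ^ 3
    ∎
  where
  open ≤-Reasoning
  a : ℕ
  a = δ ^ t
  a≥1 : 1 ≤ a
  a≥1 = m^n>0 δ {{>-nonZero δ≥1}} t
  δ≤δℓ : δ ≤ δ * ℓ
  δ≤δℓ = m≤m*n δ ℓ {{>-nonZero ℓ≥1}}
  δ≤aδℓ : δ ≤ a * (δ * ℓ)
  δ≤aδℓ = ≤-trans δ≤δℓ (m≤n*m (δ * ℓ) a {{>-nonZero a≥1}})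
  2k+1≤ : suc (k + k) ≤ (δ * ℓ + δ * ℓ) + (δ * ℓ + δ * ℓ)
  2k+1≤ = begin
    suc (k + k)                        ≤⟨ s≤s (+-monoʳ-≤ k (n≤1+n k)) ⟩
    suc k + suc k                      ≡⟨ cong₂ _+_ k-def k-def ⟩
    (δ + δ * ℓ) + (δ + δ * ℓ)          ≤⟨ +-mono-≤ (+-monoˡ-≤ _ δ≤δℓ) (+-monoˡ-≤ _ δ≤δℓ) ⟩
    (δ * ℓ + δ * ℓ) + (δ * ℓ + δ * ℓ)  ∎
  nine-times : ∀ a d l → (a + a) * ((d * l + d * l) + (d * l + d * l)) + a * (d * l) ≡ 9 * (a * (d * l))
  nine-times = solve-∀
  regroup : ∀ a d l → 10 * (a * (d * l)) ≡ 10 * (a * d) * l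
  regroup = solve-∀

lemma5p2 : (t δ ℓ : ℕ) → 1 ≤ t → 1 ≤ δ → 1 ≤ ℓ →
    (G : Graph) → ¬ HasClique G (t + 1) →
    (L : Fin (size0 t δ ℓ) → LPath G) →
    (∀ i j → i ≢ j → Disjoint {G} (Verts (L i)) (Verts (L j))) →
    (∀ i j → i ≢ j → ¬ Anticomplete G (Verts (L i)) (Verts (L j))) →
    Σ (Fin δ → Fin (size0 t δ ℓ)) λ sel →
      (∀ i j → sel i ≡ sel j → i ≡ j) ×
      Σ ((i : Fin δ) → Fin (suc (len (L (sel i))))) λ z →
      Σ (Fin δ → Fin ℓ → Fin (size0 t δ ℓ)) λ fam →
        (∀ i a j b → fam i a ≡ fam j b → (i ≡ j × a ≡ b)) ×
        (∀ i a j → fam i a ≢ sel j) ×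
        (∀ i j → i ≢ j →
          Anticomplete G (Prefix (L (sel i)) (z i)) (Prefix (L (sel j)) (z j))) ×
        (∀ i a → Σ (Fin (suc (len (L (fam i a))))) λ w →
          (vtx (L (fam i a)) w ≢ xEnd (L (fam i a))) ×
          HasNbrIn G (vtx (L (fam i a)) w) (Prefix (L (sel i)) (z i)) ×
          (∀ p → toℕ w ≤ toℕ p → p ≢ w →
            ¬ HasNbrIn G (vtx (L (fam i a)) p) (Prefix (L (sel i)) (z i))))
lemma5p2 t δ ℓ _ δ≥1 ℓ≥1 G no-clique L L-disjoint L-touching =
  sel , sel-injective , tip ∘ sel , pick , pick-injective , pick≢sel , sel-separate , pick-attached
  where
  open Graph G using () renaming (_~_ to _∼_; _~?_ to _∼?_)
  M : ℕ
  M = 10 * δ ^ (t + 3) * ℓ ^ 3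
  k : ℕ
  k = pred (δ + δ * ℓ)
  threshold : suc k ≡ δ + δ * ℓ
  threshold = suc-pred (δ + δ * ℓ) {{>-nonZero (≤-trans δ≥1 (m≤m+n δ (δ * ℓ)))}}
  ends-adjacent? : Decidable₂ (λ a b → xEnd (L a) ∼ xEnd (L b))
  ends-adjacent? a b = xEnd (L a) ∼? xEnd (L b)
  ends : Subfamily (λ a b → ¬ xEnd (L a) ∼ xEnd (L b)) M (allFin (size0 t δ ℓ))
  ends = ramsey {Q = λ _ → ⊤} ends-adjacent? M t (no-clique⇒clique-bounded G t no-clique (xEnd ∘ L))
           (allFin _) (Uniqueₚ.allFin⁺ _) (All.universal (λ _ → tt) _)
           (≤-reflexive (sym (length-tabulate id)))
  open Subfamily ends
  open HeadsAndFollowers G L L-disjoint L-touching members unique pairwise k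
  open Selection t δ ℓ no-clique threshold (≤-trans (size-bound {t} δ≥1 ℓ≥1 threshold) large)
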